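{- For each $x_i\in V_-$, it holds that $\sum_{u\in F'}\delta(u,x_i)\le d^*(x_i)$.
   Context: All graphs are finite, simple and undirected. Algorithm naive-fvs on an extended instance $(G,k,F)$, where $F\subseteq V(G)$ induces a forest; degrees are taken in the current graph $G$: 0. If $k<0$, return ``no''. If $V(G)=\emptyset$, return $\emptyset$. 1. If some vertex $v$ has degree less than two, return naive-fvs$(G-\{v\},k,F\setminus\{v\})$. 2. If some $v\in V(G)\setminus F$ has two neighbors in the same component of $G[F]$, recurse on $(G-\{v\},k-1,F)$ and add $v$ to the returned solution (return ``no'' if the recursion does). 3. Pick $v\in V(G)\setminus F$ of maximum degree. 4. If $d(v)=2$: repeatedly, while $G$ has a cycle, delete from $G$ some vertex of the cycle not in $F$ and put it into a set $X$. Return $X$ if $|X|\le k$, else ``no''. 5. Recurse on $(G-\{v\},k-1,F)$; if the result is not ``no'', return it together with $v$. 6. Return naive-fvs$(G,k,F\cup\{v\})$. Search tree. The execution started from $(G,k,\emptyset)$ is a search tree. Each node performs steps 0–4, absorbing the recursive calls of steps 1 and 2. If the node reaches step 5, it has two children, with entry instances $(G-\{v\},k-1,F)$ and $(G,k,F\cup\{v\})$. An execution path is a root-to-leaf path. Fix an execution path whose leaf returns a solution. Let $V_-$ be the set of vertices deleted along it in steps 2, 4 or 5 (the returned solution). Let $F'$ be the set of vertices moved into $F$ by step 6 along it. For $v\in V_-\cup F'$, $d^*(v)$ is the degree of $v$ in the current graph at the moment $v$ is deleted into $V_-$ or moved into $F$. Let $x_1,\dots,x_{|V_-|}$ list $V_-$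 in the order of deletion. For $u\in F'$, a decrement of the degree of $u$ is effective if it occurs after $u$ has been moved into $F$ and lowers the degree from a value at least $3$ (so only the decrements from $d^*(u)$ down to $2$ count). An effective decrement is incurred by $x_i$ if it happens after the deletion of $x_i$ and before the deletion of $x_{i+1}$, or after the deletion of $x_{|V_-|}$ when $i=|V_-|$. Then $\delta(u,x_i)$ denotes the number of effective decrements of $u$ incurred by $x_i$. -}

module Defs where

open import Data.Nat using (ℕ; zero; suc; _+_; _∸_; _⊔_; _≤_; _<_; _<ᵇ_; _≤ᵇ_)
open import Data.Bool using (Bool; true; false; _∧_; _∨_; not; if_then_else_)
open import Data.Fin using (Fin; zero; suc; toℕ; _≟_)
open import Data.List using (List; []; _∷_; length; lookup; take; foldl; _∷ʳ_)
open import Data.List.Relation.Unary.All using (All)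
open import Data.List.Relation.Unary.Linked using (Linked)
open import Data.List.Relation.Unary.Unique.Propositional using (Unique)
open import Data.Product using (Σ; ∃; _×_; _,_)
open import Relation.Binary.PropositionalEquality using (_≡_)
open import Relation.Nullary using (¬_)
open import Relation.Nullary.Decidable using (⌊_⌋)
open import Function using (_∘_)

sumᶠ : ∀ {m} → (Fin m → ℕ) → ℕ
sumᶠ {zero}  f = 0
sumᶠ {suc m} f = f zero + sumᶠ (f ∘ suc)

anyᶠ : ∀ {m} → (Fin m → Bool) → Bool
anyᶠ {zero}  f = false
anyᶠ {suc m} f = f zero ∨ anyᶠ (f ∘ suc)

record Graph (n : ℕ) : Set where
  field
    adj    : Fin n → Fin n → Bool
    sym    : ∀ u v → adj u v ≡ adj v u
    irrefl : ∀ v → adj v v ≡ false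
open Graph public

-- An extended instance (current graph, k, F): the current graph is the
-- subgraph of the original graph induced by the alive vertices
-- (the algorithm only ever deletes vertices).
record State (n : ℕ) : Set where
  constructor st
  field
    alive : Fin n → Bool
    inF   : Fin n → Bool
    k     : ℕ
open State public

initial : ∀ {n} → ℕ → State n
initial k = st (λ _ → true) (λ _ → false) k

module _ {n : ℕ} (G : Graph n) where

  deg : State n → Fin n → ℕ
  deg s v = sumᶠ (λ w → if alive s w ∧ adj G v w then 1 else 0)

  Alive : State n → Fin n → Set
  Alive s v = alive s v ≡ true

  OutF : State n → Fin n → Set
  OutF s v = Alive s v × inF s v ≡ false

  InF : State n → Fin n → Set
  InF s v = Alive s v × inF s v ≡ true

  Adj : Fin n → Fin n → Set
  Adj u v = adj G u v ≡ true

  delete : State n → Fin n → State n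
  delete s v = st (λ w → alive s w ∧ not ⌊ w ≟ v ⌋)
                  (λ w → inF s w ∧ not ⌊ w ≟ v ⌋) (k s)

  decK : State n → State n
  decK s = st (alive s) (inF s) (k s ∸ 1)

  moveToF : State n → Fin n → State n
  moveToF s v = st (alive s) (λ w → inF s w ∨ ⌊ w ≟ v ⌋) (k s)

  data SameCompF (s : State n) : Fin n → Fin n → Set where
    here : ∀ {a} → InF s a → SameCompF s a a
    step : ∀ {a b c} → InF s a → Adj a b → SameCompF s b c → SameCompF s a c

  record Cycle (s : State n) : Set where
    constructor cycle
    field
      first  : Fin n
      rest   : List (Fin n)
      long   : 2 ≤ length rest
      uniq   : Unique (first ∷ rest)
      allA   : All (Alive s) (first ∷ rest)
      closed : Linked Adj ((first ∷ rest) ∷ʳ first)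

  OnCycle : State n → Fin n → Set
  OnCycle s v = Σ (Cycle s) λ C → v ≡ Cycle.first C ⊎' (v ∈' Cycle.rest C)
    where
      open import Data.Sum using () renaming (_⊎_ to _⊎'_)
      open import Data.List.Membership.Propositional using () renaming (_∈_ to _∈'_)

  Acyclic : State n → Set
  Acyclic s = ¬ Cycle s

  NoLowDeg : State n → Set
  NoLowDeg s = ∀ v → Alive s v → 2 ≤ deg s v

  TwoNbrsSameComp : State n → Fin n → Set
  TwoNbrsSameComp s v = ∃ λ a → ∃ λ b → ¬ (a ≡ b) × Adj v a × Adj v b × SameCompF s a b

  NoStep2 : State n → Set
  NoStep2 s = ∀ v → OutF s v → ¬ TwoNbrsSameComp s v

  MaxDegOutF : State n → Fin n → Set
  MaxDegOutF s v = OutF s v × (∀ w → OutF s w → deg s w ≤ deg s v)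

  data Kind : Set where
    s1 s2 s4 s5 s6 : Kind   -- deletion by step 1/2/4/5, move into F by step 6

  record Event : Set where
    constructor ev
    field
      kind : Kind
      vtx  : Fin n
  open Event public

  apply : State n → Event → State n
  apply s (ev s1 v) = delete s v
  apply s (ev s2 v) = decK (delete s v)
  apply s (ev s4 v) = delete s v
  apply s (ev s5 v) = decK (delete s v)
  apply s (ev s6 v) = moveToF s v

  data Loop4 : State n → List Event → Set where
    done : ∀ {s} → Acyclic s → Loop4 s []
    del  : ∀ {s es} v → OutF s v → OnCycle s v →
           Loop4 (delete s v) es → Loop4 s (ev s4 v ∷ es)

  -- An execution path from a call on state s whose leaf returns a solution,
  -- recorded as the list of events along it.
  data SolPath : State n → List Event → Set where
    leaf0 : ∀ {s} → (∀ v → alive s v ≡ false) → SolPath s []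
    leaf4 : ∀ {s es} v → NoLowDeg s → NoStep2 s → MaxDegOutF s v →
            deg s v ≡ 2 → Loop4 s es → length es ≤ k s → SolPath s es
    step1 : ∀ {s es} v → Alive s v → deg s v < 2 →
            SolPath (delete s v) es → SolPath s (ev s1 v ∷ es)
    step2 : ∀ {s es} v → NoLowDeg s → OutF s v → TwoNbrsSameComp s v →
            1 ≤ k s → SolPath (apply s (ev s2 v)) es → SolPath s (ev s2 v ∷ es)
    step5 : ∀ {s es} v → NoLowDeg s → NoStep2 s → MaxDegOutF s v →
            ¬ (deg s v ≡ 2) → 1 ≤ k s →
            SolPath (apply s (ev s5 v)) es → SolPath s (ev s5 v ∷ es)
    step6 : ∀ {s es} v → NoLowDeg s → NoStep2 s → MaxDegOutF s v →
            ¬ (deg s v ≡ 2) →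
            SolPath (moveToF s v) es → SolPath s (ev s6 v ∷ es)

  isVminus : Event → Bool
  isVminus (ev s2 _) = true
  isVminus (ev s4 _) = true
  isVminus (ev s5 _) = true
  isVminus (ev _  _) = false

  isMoveOf : Event → Fin n → Bool
  isMoveOf (ev s6 v) u = ⌊ u ≟ v ⌋
  isMoveOf (ev _  _) u = false

  module Along (s₀ : State n) (es : List Event) where

    Pos : Set
    Pos = Fin (length es)

    event : Pos → Event
    event = lookup es

    before : Pos → State n
    before q = foldl apply s₀ (take (toℕ q) es)

    after : Pos → State n
    after q = apply (before q) (event q)

    inF' : Fin n → Bool
    inF' u = anyᶠ (λ r → isMoveOf (event r) u)

    movedBefore : Pos → Fin n → Bool
    movedBefore q u = anyᶠ (λ r → (toℕ r <ᵇ toℕ q) ∧ isMoveOf (event r) u)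

    effective : Fin n → Pos → ℕ
    effective u q =
      if movedBefore q u ∧ alive (after q) u
      then deg (before q) u ∸ (deg (after q) u ⊔ 2)
      else 0

    inWindow : Pos → Pos → Bool
    inWindow p q = (toℕ p ≤ᵇ toℕ q) ∧
      not (anyᶠ (λ r → (toℕ p <ᵇ toℕ r) ∧ (toℕ r ≤ᵇ toℕ q) ∧ isVminus (event r)))

    δ : Fin n → Pos → ℕ
    δ u p = sumᶠ (λ q → if inWindow p q then effective u q else 0)

    sumδ : Pos → ℕ
    sumδ p = sumᶠ (λ u → if inF' u then δ u p else 0)

    dstar : Pos → ℕ
    dstar p = deg (before p) (vtx (event p))

-- Give every vertex of the current graph the deficit max(0, 2 − deg). When a
-- vertex v is deleted, each unit of degree lost by a neighbour u is either an
-- effective decrement of u (u keeps degree ≥ 2) or raises the deficit of u by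
-- one, while the deficit of v disappears. The decrements incurred by x ∈ V₋
-- happen in the window from its deletion to the next deletion into V₋. They are
-- paid for by x itself (at most d*(x) of them, since no vertex has a deficit
-- when x is deleted) and by the step-1 deletions in the window, each of which
-- (degree d < 2) pays d and releases its deficit 2 − d ≥ d. Moves into F change
-- no degree, and inside the loop of step 4 a window is just its own deletion.
-- Counting the decrements of all vertices, not only those of F', can only
-- enlarge the sum.
module Submission where

open import Defs hiding (sym)
open import Data.Bool using (Bool; true; false; _∧_; _∨_; not; if_then_else_)
open import Data.Bool.Properties using (∧-zeroʳ; ∧-identityʳ)
open import Data.Fin using (Fin; zero; suc; toℕ; _≟_)
open import Data.List using (List; []; _∷_; length; lookup)
open import Data.Nat using (ℕ; zero; suc; _+_; _∸_; _⊔_; _≤_; _<_; _<ᵇ_; _≤ᵇ_; z≤n; s≤s)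
open import Data.Nat.Properties
  using (≤-refl; ≤-trans; ≤-reflexive; +-comm; +-identityʳ; +-mono-≤; +-monoˡ-≤; +-monoʳ-≤;
         +-cancelʳ-≤; m≤m+n; m≤m⊔n; ⊔-identityʳ; m≤n⇒m∸n≡0; 0∸n≡0; ∸-monoʳ-≤; m+n∸m≡n;
         +-0-commutativeMonoid; module ≤-Reasoning)
open import Algebra.Properties.CommutativeMonoid.Sum +-0-commutativeMonoid
  using (sum; ∑-distrib-+; ∑-comm)
open import Function using (_∘_; flip)
open import Relation.Binary.PropositionalEquality
  using (_≡_; refl; sym; trans; cong; cong₂; module ≡-Reasoning)
open import Relation.Nullary using (yes; no)
open import Relation.Nullary.Decidable using (⌊_⌋; isYes≗does)

sumᶠ≡sum : ∀ {m} (f : Fin m → ℕ) → sumᶠ f ≡ sum f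
sumᶠ≡sum {zero}  f = refl
sumᶠ≡sum {suc m} f = cong (f zero +_) (sumᶠ≡sum (f ∘ suc))

sumᶠ-cong : ∀ {m} {f g : Fin m → ℕ} → (∀ i → f i ≡ g i) → sumᶠ f ≡ sumᶠ g
sumᶠ-cong {zero}  f≗g = refl
sumᶠ-cong {suc m} f≗g = cong₂ _+_ (f≗g zero) (sumᶠ-cong (f≗g ∘ suc))

sumᶠ-mono-≤ : ∀ {m} {f g : Fin m → ℕ} → (∀ i → f i ≤ g i) → sumᶠ f ≤ sumᶠ g
sumᶠ-mono-≤ {zero}  f≤g = z≤n
sumᶠ-mono-≤ {suc m} f≤g = +-mono-≤ (f≤g zero) (sumᶠ-mono-≤ (f≤g ∘ suc))

sumᶠ-zero : ∀ {m} {f : Fin m → ℕ} → (∀ i → f i ≡ 0) → sumᶠ f ≡ 0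
sumᶠ-zero {zero}  f≗0 = refl
sumᶠ-zero {suc m} f≗0 = cong₂ _+_ (f≗0 zero) (sumᶠ-zero (f≗0 ∘ suc))

sumᶠ-distrib-+ : ∀ {m} (f g : Fin m → ℕ) → sumᶠ (λ i → f i + g i) ≡ sumᶠ f + sumᶠ g
sumᶠ-distrib-+ f g = begin
  sumᶠ (λ i → f i + g i) ≡⟨ sumᶠ≡sum (λ i → f i + g i) ⟩
  sum (λ i → f i + g i)  ≡⟨ ∑-distrib-+ f g ⟩
  sum f + sum g          ≡⟨ cong₂ _+_ (sumᶠ≡sum f) (sumᶠ≡sum g) ⟨
  sumᶠ f + sumᶠ g        ∎
  where open ≡-Reasoning

sumᶠ-comm : ∀ {m k} (f : Fin m → Fin k → ℕ) →
            sumᶠ (λ i → sumᶠ (f i)) ≡ sumᶠ (λ j → sumᶠ (λ i → f i j))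
sumᶠ-comm f = trans (sumᶠ²≡sum² f) (trans (∑-comm f) (sym (sumᶠ²≡sum² (flip f))))
  where
  sumᶠ²≡sum² : ∀ {m k} (g : Fin m → Fin k → ℕ) →
               sumᶠ (λ i → sumᶠ (g i)) ≡ sum (λ i → sum (g i))
  sumᶠ²≡sum² g = trans (sumᶠ-cong (sumᶠ≡sum ∘ g)) (sumᶠ≡sum (λ i → sum (g i)))

sumᶠ-if : ∀ {m} (b : Bool) (f : Fin m → ℕ) →
          sumᶠ (λ i → if b then f i else 0) ≡ (if b then sumᶠ f else 0)
sumᶠ-if     true  f = refl
sumᶠ-if {m} false f = sumᶠ-zero {m} (λ _ → refl)

⌊suc≟suc⌋ : ∀ {m} (i j : Fin m) → ⌊ suc i ≟ suc j ⌋ ≡ ⌊ i ≟ j ⌋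
⌊suc≟suc⌋ i j = trans (isYes≗does (suc i ≟ suc j)) (sym (isYes≗does (i ≟ j)))

pointMass : ∀ {m} → Fin m → ℕ → Fin m → ℕ
pointMass j c i = if ⌊ i ≟ j ⌋ then c else 0

sumᶠ-pointMass : ∀ {m} (j : Fin m) (c : ℕ) → sumᶠ (pointMass j c) ≡ c
sumᶠ-pointMass {suc m} zero    c = trans (cong (c +_) (sumᶠ-zero {m} (λ _ → refl))) (+-identityʳ c)
sumᶠ-pointMass         (suc j) c =
  trans (sumᶠ-cong (λ i → cong (if_then c else 0) (⌊suc≟suc⌋ i j))) (sumᶠ-pointMass j c)

𝟙 : Bool → ℕ
𝟙 b = if b then 1 else 0

𝟙-∧-≤ : ∀ x y → 𝟙 (x ∧ y) ≤ 𝟙 y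
𝟙-∧-≤ true  y = ≤-refl
𝟙-∧-≤ false y = z≤n

if-≤ : ∀ b x → (if b then x else 0) ≤ x
if-≤ true  x = ≤-refl
if-≤ false x = z≤n

if-mono-≤ : ∀ b {x y} → x ≤ y → (if b then x else 0) ≤ (if b then y else 0)
if-mono-≤ true  x≤y = x≤y
if-mono-≤ false x≤y = z≤n

m∸[m⊔n]≡0 : ∀ m n → m ∸ (m ⊔ n) ≡ 0
m∸[m⊔n]≡0 m n = m≤n⇒m∸n≡0 (m≤m⊔n m n)

m+n∸[m⊔o]≤n : ∀ m n o → m + n ∸ (m ⊔ o) ≤ n
m+n∸[m⊔o]≤n m n o = ≤-trans (∸-monoʳ-≤ (m + n) (m≤m⊔n m o)) (≤-reflexive (m+n∸m≡n m n))

m<2⇒m≤2∸m : ∀ {m} → m < 2 → m ≤ 2 ∸ m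
m<2⇒m≤2∸m {zero}        _               = z≤n
m<2⇒m≤2∸m {suc zero}    _               = s≤s z≤n
m<2⇒m≤2∸m {suc (suc _)} (s≤s (s≤s ()))

-- A degree d + i dropping to d: the effective part of the drop plus the new
-- deficit equals the old deficit plus the drop.
drop-deficit-balance : ∀ d i → d + i ∸ (d ⊔ 2) + (2 ∸ d) ≡ 2 ∸ (d + i) + i
drop-deficit-balance zero          zero          = refl
drop-deficit-balance zero          (suc zero)    = refl
drop-deficit-balance zero          (suc (suc i)) rewrite 0∸n≡0 i = +-comm i 2
drop-deficit-balance (suc zero)    zero          = refl
drop-deficit-balance (suc zero)    (suc i)       rewrite 0∸n≡0 i = +-comm i 1
drop-deficit-balance (suc (suc d)) i
  rewrite 0∸n≡0 d | 0∸n≡0 (d + i) | ⊔-identityʳ d | +-identityʳ (d + i ∸ d) = m+n∸m≡n d i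

module _ {n : ℕ} (G : Graph n) where

  deg-delete : ∀ s v u → deg G s u ≡ deg G (delete G s v) u + 𝟙 (alive s v ∧ adj G u v)
  deg-delete s v u = begin
    deg G s u
      ≡⟨ sumᶠ-cong split ⟩
    sumᶠ (λ w → 𝟙 ((alive s w ∧ not ⌊ w ≟ v ⌋) ∧ adj G u w) + pointMass v lost w)
      ≡⟨ sumᶠ-distrib-+ (λ w → 𝟙 ((alive s w ∧ not ⌊ w ≟ v ⌋) ∧ adj G u w)) (pointMass v lost) ⟩
    deg G (delete G s v) u + sumᶠ (pointMass v lost)
      ≡⟨ cong (deg G (delete G s v) u +_) (sumᶠ-pointMass v lost) ⟩
    deg G (delete G s v) u + lost ∎
    where
    open ≡-Reasoning
    lost = 𝟙 (alive s v ∧ adj G u v)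
    split : ∀ w → 𝟙 (alive s w ∧ adj G u w) ≡
                  𝟙 ((alive s w ∧ not ⌊ w ≟ v ⌋) ∧ adj G u w) + (pointMass v lost w)
    split w with w ≟ v
    ... | yes refl rewrite ∧-zeroʳ (alive s w) = refl
    ... | no _     rewrite ∧-identityʳ (alive s w) = sym (+-identityʳ _)

  deficit : State n → Fin n → ℕ
  deficit s u = if alive s u then 2 ∸ deg G s u else 0

  totalDeficit : State n → ℕ
  totalDeficit s = sumᶠ (deficit s)

  -- The effective decrements of u between s and s′ (the decrements from a
  -- degree ≥ 3), counted for every surviving u, whether in F or not.
  drop : State n → State n → Fin n → ℕ
  drop s s′ u = if alive s′ u then deg G s u ∸ (deg G s′ u ⊔ 2) else 0

  totalDrop : State n → State n → ℕ
  totalDrop s s′ = sumᶠ (drop s s′)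

  totalDeficit-noLowDeg : ∀ s → NoLowDeg G s → totalDeficit s ≡ 0
  totalDeficit-noLowDeg s noLow = sumᶠ-zero pointwise
    where
    pointwise : ∀ u → deficit s u ≡ 0
    pointwise u with alive s u in eq
    ... | true  = m≤n⇒m∸n≡0 (noLow u eq)
    ... | false = refl

  totalDrop-moveToF : ∀ s v → totalDrop s (moveToF G s v) ≡ 0
  totalDrop-moveToF s v = sumᶠ-zero pointwise
    where
    pointwise : ∀ u → drop s (moveToF G s v) u ≡ 0
    pointwise u with alive s u
    ... | true  = m∸[m⊔n]≡0 (deg G s u) 2
    ... | false = refl

  𝟙[alive∧adj]≤𝟙[adj] : ∀ s v u → 𝟙 (alive s v ∧ adj G u v) ≤ 𝟙 (adj G v u)
  𝟙[alive∧adj]≤𝟙[adj] s v u rewrite Graph.sym G u v = 𝟙-∧-≤ (alive s v) (adj G v u)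

  drop-delete≤adj : ∀ s v u → drop s (delete G s v) u ≤ 𝟙 (alive s u ∧ adj G v u)
  drop-delete≤adj s v u with u ≟ v | alive s u
  ... | yes refl | true  = z≤n
  ... | yes refl | false = z≤n
  ... | no _     | false = z≤n
  ... | no _     | true  rewrite deg-delete s v u =
    ≤-trans (m+n∸[m⊔o]≤n (deg G (delete G s v) u) _ 2) (𝟙[alive∧adj]≤𝟙[adj] s v u)

  totalDrop-delete≤deg : ∀ s v → totalDrop s (delete G s v) ≤ deg G s v
  totalDrop-delete≤deg s v = sumᶠ-mono-≤ (drop-delete≤adj s v)

  drop+deficit-delete : ∀ s v u →
    drop s (delete G s v) u + deficit (delete G s v) u + pointMass v (deficit s v) u
      ≤ deficit s u + 𝟙 (alive s u ∧ adj G v u)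
  drop+deficit-delete s v u with u ≟ v
  drop+deficit-delete s v u | yes refl with alive s u
  ... | true  = m≤m+n _ _
  ... | false = z≤n
  drop+deficit-delete s v u | no _ with alive s u
  ... | false = z≤n
  ... | true  rewrite deg-delete s v u = ≤-trans
    (≤-reflexive (trans (+-identityʳ _) (drop-deficit-balance (deg G (delete G s v) u) _)))
    (+-monoʳ-≤ _ (𝟙[alive∧adj]≤𝟙[adj] s v u))

  totalDrop+totalDeficit-delete : ∀ s v →
    totalDrop s (delete G s v) + totalDeficit (delete G s v) + deficit s v
      ≤ totalDeficit s + deg G s v
  totalDrop+totalDeficit-delete s v = begin
    totalDrop s s′ + totalDeficit s′ + deficit s v
      ≡⟨ cong₂ _+_ (sumᶠ-distrib-+ (drop s s′) (deficit s′)) (sumᶠ-pointMass v _) ⟨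
    sumᶠ (λ u → drop s s′ u + deficit s′ u) + sumᶠ (pointMass v (deficit s v))
      ≡⟨ sumᶠ-distrib-+ (λ u → drop s s′ u + deficit s′ u) (pointMass v (deficit s v)) ⟨
    sumᶠ (λ u → drop s s′ u + deficit s′ u + pointMass v (deficit s v) u)
      ≤⟨ sumᶠ-mono-≤ (drop+deficit-delete s v) ⟩
    sumᶠ (λ u → deficit s u + 𝟙 (alive s u ∧ adj G v u))
      ≡⟨ sumᶠ-distrib-+ (deficit s) _ ⟩
    totalDeficit s + deg G s v ∎
    where
    open ≤-Reasoning
    s′ = delete G s v

  deg<2⇒deg≤deficit : ∀ s v → alive s v ≡ true → deg G s v < 2 → deg G s v ≤ deficit s v
  deg<2⇒deg≤deficit s v v-alive low rewrite v-alive = m<2⇒m≤2∸m low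

anyᶠ-false : ∀ {m} → anyᶠ {m} (λ _ → false) ≡ false
anyᶠ-false {zero}  = refl
anyᶠ-false {suc m} = anyᶠ-false {m}

anyᶠ-cong : ∀ {m} {f g : Fin m → Bool} → (∀ i → f i ≡ g i) → anyᶠ f ≡ anyᶠ g
anyᶠ-cong {zero}  f≗g = refl
anyᶠ-cong {suc m} f≗g = cong₂ _∨_ (f≗g zero) (anyᶠ-cong (f≗g ∘ suc))

suc≤ᵇsuc : ∀ m n → (suc m ≤ᵇ suc n) ≡ (m ≤ᵇ n)
suc≤ᵇsuc zero    n = refl
suc≤ᵇsuc (suc m) n = refl

module _ {n : ℕ} (G : Graph n) where

  leadingDrop : State n → List (Event G) → ℕ
  leadingDrop s []       = 0
  leadingDrop s (e ∷ es) =
    if isVminus G e then 0 else totalDrop G s (apply G s e) + leadingDrop (apply G s e) es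

  leadingDrop-Loop4 : ∀ {s es} → Loop4 G s es → leadingDrop s es ≡ 0
  leadingDrop-Loop4 (done _)      = refl
  leadingDrop-Loop4 (del _ _ _ _) = refl

  leadingDrop≤totalDeficit : ∀ {s es} → SolPath G s es → leadingDrop s es ≤ totalDeficit G s
  leadingDrop≤totalDeficit (leaf0 _) = z≤n
  leadingDrop≤totalDeficit (leaf4 _ _ _ _ _ loop _) =
    ≤-trans (≤-reflexive (leadingDrop-Loop4 loop)) z≤n
  leadingDrop≤totalDeficit {s} {_ ∷ es} (step1 v v-alive low path) =
    +-cancelʳ-≤ (deficit G s v) _ (totalDeficit G s) (begin
      totalDrop G s s′ + leadingDrop s′ es + deficit G s v
        ≤⟨ +-monoˡ-≤ (deficit G s v)
                     (+-monoʳ-≤ (totalDrop G s s′) (leadingDrop≤totalDeficit path)) ⟩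
      totalDrop G s s′ + totalDeficit G s′ + deficit G s v
        ≤⟨ totalDrop+totalDeficit-delete G s v ⟩
      totalDeficit G s + deg G s v
        ≤⟨ +-monoʳ-≤ (totalDeficit G s) (deg<2⇒deg≤deficit G s v v-alive low) ⟩
      totalDeficit G s + deficit G s v ∎)
    where
    open ≤-Reasoning
    s′ = delete G s v
  leadingDrop≤totalDeficit (step2 _ _ _ _ _ _)   = z≤n
  leadingDrop≤totalDeficit (step5 _ _ _ _ _ _ _) = z≤n
  leadingDrop≤totalDeficit {s} (step6 v _ _ _ _ path)
    rewrite totalDrop-moveToF G s v = leadingDrop≤totalDeficit path

  noVminusUpTo : (es : List (Event G)) → Fin (length es) → Bool
  noVminusUpTo es q = not (anyᶠ (λ r → (toℕ r ≤ᵇ toℕ q) ∧ isVminus G (lookup es r)))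

  noVminusUpTo-zero : ∀ e es → noVminusUpTo (e ∷ es) zero ≡ not (isVminus G e)
  noVminusUpTo-zero e es with isVminus G e
  ... | true  = refl
  ... | false = cong not (anyᶠ-false {length es})

  noVminusUpTo-suc : ∀ e es q →
                     noVminusUpTo (e ∷ es) (suc q) ≡ not (isVminus G e) ∧ noVminusUpTo es q
  noVminusUpTo-suc e es q with isVminus G e
  ... | true  = refl
  ... | false = cong not (anyᶠ-cong (λ r →
                  cong (_∧ isVminus G (lookup es r)) (suc≤ᵇsuc (toℕ r) (toℕ q))))

  module _ (s₀ : State n) (es : List (Event G)) where
    open Along G s₀ es

    stepDrop : Pos → ℕ
    stepDrop q = totalDrop G (before q) (after q)

    windowDrop : Pos → ℕ
    windowDrop p = sumᶠ (λ q → if inWindow p q then stepDrop q else 0)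

  sumᶠ-noVminusUpTo : ∀ s es →
    sumᶠ (λ q → if noVminusUpTo es q then stepDrop s es q else 0) ≡ leadingDrop s es
  sumᶠ-noVminusUpTo s []       = refl
  sumᶠ-noVminusUpTo s (e ∷ es) = trans
    (cong₂ _+_ (cong (if_then totalDrop G s s′ else 0) (noVminusUpTo-zero e es))
               (sumᶠ-cong (λ q → cong (if_then stepDrop s′ es q else 0) (noVminusUpTo-suc e es q))))
    (byKind (isVminus G e))
    where
    s′ = apply G s e
    byKind : ∀ b → (if not b then totalDrop G s s′ else 0)
                   + sumᶠ (λ q → if not b ∧ noVminusUpTo es q then stepDrop s′ es q else 0)
                 ≡ (if b then 0 else totalDrop G s s′ + leadingDrop s′ es)
    byKind true  = sumᶠ-zero {length es} (λ _ → refl)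
    byKind false = cong (totalDrop G s s′ +_) (sumᶠ-noVminusUpTo s′ es)

  windowDrop-zero : ∀ s e es →
    windowDrop s (e ∷ es) zero ≡ totalDrop G s (apply G s e) + leadingDrop (apply G s e) es
  windowDrop-zero s e es = cong₂ _+_
    (cong (if_then totalDrop G s s′ else 0) (cong not (anyᶠ-false {length es})))
    (trans (sumᶠ-cong (λ q → cong (if_then stepDrop s′ es q else 0) (inWindow-zero-suc q)))
           (sumᶠ-noVminusUpTo s′ es))
    where
    s′ = apply G s e
    inWindow-zero-suc : ∀ q → Along.inWindow G s (e ∷ es) zero (suc q) ≡ noVminusUpTo es q
    inWindow-zero-suc q = cong not (anyᶠ-cong (λ r →
      cong (_∧ isVminus G (lookup es r)) (suc≤ᵇsuc (toℕ r) (toℕ q))))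

  windowDrop-suc : ∀ s e es p → windowDrop s (e ∷ es) (suc p) ≡ windowDrop (apply G s e) es p
  windowDrop-suc s e es p = sumᶠ-cong (λ q →
    cong (if_then stepDrop (apply G s e) es q else 0) (inWindow-suc q))
    where
    inWindow-suc : ∀ q →
      Along.inWindow G s (e ∷ es) (suc p) (suc q) ≡ Along.inWindow G (apply G s e) es p q
    inWindow-suc q = cong₂ _∧_ (suc≤ᵇsuc (toℕ p) (toℕ q))
      (cong not (anyᶠ-cong (λ r → cong (λ b → (toℕ p <ᵇ toℕ r) ∧ b ∧ isVminus G (lookup es r))
                                       (suc≤ᵇsuc (toℕ r) (toℕ q)))))

  windowDrop≤dstar-suc : ∀ s e es p →
    windowDrop (apply G s e) es p ≤ Along.dstar G (apply G s e) es p →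
    windowDrop s (e ∷ es) (suc p) ≤ Along.dstar G s (e ∷ es) (suc p)
  windowDrop≤dstar-suc s e es p = ≤-trans (≤-reflexive (windowDrop-suc s e es p))

  windowDrop≤dstar-Loop4 : ∀ {s es} → Loop4 G s es → (p : Fin (length es)) →
                           windowDrop s es p ≤ Along.dstar G s es p
  windowDrop≤dstar-Loop4 {s} {e ∷ es} (del v _ _ loop) zero = begin
    windowDrop s (e ∷ es) zero            ≡⟨ windowDrop-zero s e es ⟩
    totalDrop G s s′ + leadingDrop s′ es  ≡⟨ cong (totalDrop G s s′ +_) (leadingDrop-Loop4 loop) ⟩
    totalDrop G s s′ + 0                  ≡⟨ +-identityʳ _ ⟩
    totalDrop G s s′                      ≤⟨ totalDrop-delete≤deg G s v ⟩
    deg G s v                             ∎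
    where
    open ≤-Reasoning
    s′ = delete G s v
  windowDrop≤dstar-Loop4 {s} {e ∷ es} (del _ _ _ loop) (suc p) =
    windowDrop≤dstar-suc s e es p (windowDrop≤dstar-Loop4 loop p)

  deletionWindow≤deg : ∀ s v es → NoLowDeg G s → SolPath G (decK G (delete G s v)) es →
    totalDrop G s (delete G s v) + leadingDrop (decK G (delete G s v)) es ≤ deg G s v
  deletionWindow≤deg s v es noLow path = begin
    totalDrop G s s′ + leadingDrop (decK G s′) es
      ≤⟨ +-monoʳ-≤ (totalDrop G s s′) (leadingDrop≤totalDeficit path) ⟩
    totalDrop G s s′ + totalDeficit G s′
      ≤⟨ m≤m+n _ (deficit G s v) ⟩
    totalDrop G s s′ + totalDeficit G s′ + deficit G s v
      ≤⟨ totalDrop+totalDeficit-delete G s v ⟩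
    totalDeficit G s + deg G s v
      ≡⟨ cong (_+ deg G s v) (totalDeficit-noLowDeg G s noLow) ⟩
    deg G s v ∎
    where
    open ≤-Reasoning
    s′ = delete G s v

  windowDrop≤dstar : ∀ {s es} → SolPath G s es → (p : Fin (length es)) →
                     isVminus G (Along.event G s es p) ≡ true →
                     windowDrop s es p ≤ Along.dstar G s es p
  windowDrop≤dstar (leaf4 _ _ _ _ _ loop _) p _ = windowDrop≤dstar-Loop4 loop p
  windowDrop≤dstar {s} {e ∷ es} (step2 v noLow _ _ _ path) zero _ =
    ≤-trans (≤-reflexive (windowDrop-zero s e es)) (deletionWindow≤deg s v es noLow path)
  windowDrop≤dstar {s} {e ∷ es} (step5 v noLow _ _ _ _ path) zero _ =
    ≤-trans (≤-reflexive (windowDrop-zero s e es)) (deletionWindow≤deg s v es noLow path)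
  windowDrop≤dstar {s} {e ∷ es} (step1 _ _ _ path) (suc p) x-Vminus =
    windowDrop≤dstar-suc s e es p (windowDrop≤dstar path p x-Vminus)
  windowDrop≤dstar {s} {e ∷ es} (step2 _ _ _ _ _ path) (suc p) x-Vminus =
    windowDrop≤dstar-suc s e es p (windowDrop≤dstar path p x-Vminus)
  windowDrop≤dstar {s} {e ∷ es} (step5 _ _ _ _ _ _ path) (suc p) x-Vminus =
    windowDrop≤dstar-suc s e es p (windowDrop≤dstar path p x-Vminus)
  windowDrop≤dstar {s} {e ∷ es} (step6 _ _ _ _ _ path) (suc p) x-Vminus =
    windowDrop≤dstar-suc s e es p (windowDrop≤dstar path p x-Vminus)

module _ {n : ℕ} (G : Graph n) (s₀ : State n) (es : List (Event G)) where
  open Along G s₀ es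

  sumδ≤windowDrop : ∀ p → sumδ p ≤ windowDrop G s₀ es p
  sumδ≤windowDrop p = begin
    sumᶠ (λ u → if inF' u then δ u p else 0)
      ≤⟨ sumᶠ-mono-≤ (λ u → if-≤ (inF' u) (δ u p)) ⟩
    sumᶠ (λ u → sumᶠ (λ q → if inWindow p q then effective u q else 0))
      ≤⟨ sumᶠ-mono-≤ (λ u → sumᶠ-mono-≤ (λ q → if-mono-≤ (inWindow p q) (effective≤drop u q))) ⟩
    sumᶠ (λ u → sumᶠ (λ q → if inWindow p q then drop G (before q) (after q) u else 0))
      ≡⟨ sumᶠ-comm (λ u q → if inWindow p q then drop G (before q) (after q) u else 0) ⟩
    sumᶠ (λ q → sumᶠ (λ u → if inWindow p q then drop G (before q) (after q) u else 0))
      ≡⟨ sumᶠ-cong (λ q → sumᶠ-if (inWindow p q) (drop G (before q) (after q))) ⟩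
    windowDrop G s₀ es p ∎
    where
    open ≤-Reasoning
    effective≤drop : ∀ u q → effective u q ≤ drop G (before q) (after q) u
    effective≤drop u q with movedBefore q u
    ... | true  = ≤-refl
    ... | false = z≤n

lemma2 : ∀ {n} (G : Graph n) (k : ℕ) (es : List (Event G)) →
         SolPath G (initial k) es →
         (p : Fin (length es)) → isVminus G (Along.event G (initial k) es p) ≡ true →
         Along.sumδ G (initial k) es p ≤ Along.dstar G (initial k) es p
lemma2 G k es path p x-Vminus =
  ≤-trans (sumδ≤windowDrop G (initial k) es p) (windowDrop≤dstar G path p x-Vminus)
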